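{- Let $m\geq 3$, $n\geq 1$, let $H\subseteq S_m$ be a fixing subgroup, and let $f:S_m^n\to S_m/H$ be an $H$-social aggregator satisfying IR: for every $i\in[n]$, $j\in[m]$, $x^{ -i}\in S_m^{n-1}$ and $x_i,y_i\in S_m$ with $x_i^{ -1}(j)=y_i^{ -1}(j)$, the $j$-profiles of $f(x^{ -i},x_i)$ and of $f(x^{ -i},y_i)$ coincide (as multisets). Then either $f$ is constant, or there exist a voter $i\in[n]$ and $y\in S_m$ such that for every $x\in S_m^n$, $$f(x)=\{x_i\circ y\circ h:\ h\in H\}.$$
   Context: $S_m$ is the symmetric group on $[m]$; a ranking $x\in S_m$ uses the convention $x(\text{rank})=\text{name}$, so $x^{ -1}(j)$ is the rank of alternative $j$. Profiles are $x=(x_1,\dots,x_n)\in S_m^n$; $(x^{ -i},y_i)$ denotes $x$ with $x_i$ replaced by $y_i$. $\circ$ is ordinary composition $(u\circ v)(r)=u(v(r))$. A subgroup $H\subseteq S_m$ is fixing if there is a partition of the rank set $[m]$ into $k\geq 2$ nonempty blocks $B_1,\dots,B_k$ with $H=\{h\in S_m: h(B_l)=B_l\text{ for all }l\}$. For $y\in S_m$ its coset is $Hy:=\{y\circ h: h\in H\}$ (the rankings obtained from $y$ by permuting ranks inside each block), and $S_m/H$ is the set of these cosets; an $H$-social aggregator is a map $S_m^n\to S_m/H$. (E.g. $H$ trivial gives full rankings; $H$ the stabilizer of rank $1$ gives a single winner.) The $j$-profile of a coset $K$ is the multiset $K^{ -1}(j)=\{z^{ -1}(j): z\in K\}$. The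 paper writes the dictatorial form as "$Hy\circ x_i$", composing permutations left to right; this is the coset displayed in the claim. -}

module Defs where

open import Data.Nat using (ℕ; _≤_)
open import Data.Fin using (Fin; _≟_)
open import Data.Fin.Permutation using (Permutation′; _⟨$⟩ʳ_; _⟨$⟩ˡ_)
open import Data.Product using (Σ; ∃; _×_; _,_; proj₁)
open import Relation.Binary.PropositionalEquality using (_≡_)
open import Relation.Nullary using (yes; no)
open import Function.Bundles using (_⇔_)

-- S_m : permutations of the rank set Fin m.
-- Convention: x ⟨$⟩ʳ rank = name, so x ⟨$⟩ˡ j = x⁻¹(j) is the rank of alternative j.
Perm : ℕ → Set
Perm m = Permutation′ m

_≈ₚ_ : ∀ {m} → Perm m → Perm m → Set
_≈ₚ_ {m} u v = ∀ (r : Fin m) → u ⟨$⟩ʳ r ≡ v ⟨$⟩ʳ r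

rank : ∀ {m} → Perm m → Fin m → Fin m
rank z j = z ⟨$⟩ˡ j

Profile : ℕ → ℕ → Set
Profile m n = Fin n → Perm m

update : ∀ {m n} → Profile m n → Fin n → Perm m → Profile m n
update x i y k with k ≟ i
... | yes _ = y
... | no _ = x k

-- A partition of the rank set [m] into k blocks B_1..B_k, given by the
-- block-assignment map b; blocks nonempty = b surjective.
Surjective : ∀ {m k} → (Fin m → Fin k) → Set
Surjective {m} {k} b = ∀ (l : Fin k) → ∃ λ (r : Fin m) → b r ≡ l

-- The fixing subgroup H = { h : h(B_l) = B_l for all l }.
-- h(B_l) ⊆ B_l : b (h r) ≡ b r ; B_l ⊆ h(B_l) : b (h⁻¹ s) ≡ b s.
InH : ∀ {m k} → (Fin m → Fin k) → Perm m → Set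
InH {m} b h = (∀ (r : Fin m) → b (h ⟨$⟩ʳ r) ≡ b r) × (∀ (s : Fin m) → b (h ⟨$⟩ˡ s) ≡ b s)

InCosetOf : ∀ {m k} → (Fin m → Fin k) → (Fin m → Fin m) → Perm m → Set
InCosetOf {m} b c z = ∃ λ (h : Perm m) → InH b h × (∀ (r : Fin m) → z ⟨$⟩ʳ r ≡ c (h ⟨$⟩ʳ r))

InCoset : ∀ {m k} → (Fin m → Fin k) → Perm m → Perm m → Set
InCoset b y z = InCosetOf b (y ⟨$⟩ʳ_) z

SameSet : ∀ {m} → (Perm m → Set) → (Perm m → Set) → Set
SameSet {m} P Q = ∀ (z : Perm m) → P z ⇔ Q z

Elt : ∀ {m k} → (Fin m → Fin k) → Perm m → Set
Elt {m} b y = Σ (Perm m) (InCoset b y)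

-- Equality of the j-profiles (multisets {z⁻¹(j) : z ∈ K}) of cosets Hy₁ and Hy₂:
-- a bijection between the cosets (as subsets of S_m, i.e. up to ≈ₚ)
-- preserving the rank of j.
SameJProfile : ∀ {m k} → (Fin m → Fin k) → Fin m → Perm m → Perm m → Set
SameJProfile {m} b j y₁ y₂ =
  Σ (Elt b y₁ → Elt b y₂) λ φ → Σ (Elt b y₂ → Elt b y₁) λ ψ →
    (∀ a a' → proj₁ a ≈ₚ proj₁ a' → proj₁ (φ a) ≈ₚ proj₁ (φ a'))
  × (∀ c c' → proj₁ c ≈ₚ proj₁ c' → proj₁ (ψ c) ≈ₚ proj₁ (ψ c'))
  × (∀ a → proj₁ (ψ (φ a)) ≈ₚ proj₁ a)
  × (∀ c → proj₁ (φ (ψ c)) ≈ₚ proj₁ c)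
  × (∀ a → rank (proj₁ (φ a)) j ≡ rank (proj₁ a) j)

-- An H-social aggregator f : S_m^n → S_m/H, given by a choice of coset
-- representatives g (f(x) = H g(x)); well-definedness on S_m^n:
WellDefined : ∀ {m n k} → (Fin m → Fin k) → (Profile m n → Perm m) → Set
WellDefined {m} {n} b g = ∀ (x x' : Profile m n) → (∀ i → x i ≈ₚ x' i) →
  SameSet (InCoset b (g x)) (InCoset b (g x'))

IR : ∀ {m n k} → (Fin m → Fin k) → (Profile m n → Perm m) → Set
IR {m} {n} b g = ∀ (i : Fin n) (j : Fin m) (x : Profile m n) (yᵢ : Perm m) →
  rank (x i) j ≡ rank yᵢ j → SameJProfile b j (g x) (g (update x i yᵢ))

Constant : ∀ {m n k} → (Fin m → Fin k) → (Profile m n → Perm m) → Set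
Constant {m} {n} b g = ∀ (x x' : Profile m n) → SameSet (InCoset b (g x)) (InCoset b (g x'))

Dictatorial : ∀ {m n k} → (Fin m → Fin k) → (Profile m n → Perm m) → Set
Dictatorial {m} {n} b g = ∃ λ (i : Fin n) → ∃ λ (y : Perm m) → ∀ (x : Profile m n) →
  SameSet (InCoset b (g x)) (InCosetOf b (λ r → x i ⟨$⟩ʳ (y ⟨$⟩ʳ r)))

module Submission where

-- Write β x j for the block (of the partition defining H) that
-- contains the rank of alternative j in f(x).  A coset Hy is determined by
-- the map j ↦ block of the rank of j in y, so f is known once β is known.
--   (1) Well-definedness and IR imply that β x j depends only on the vector of
--       ranks the voters give to j: β x j = F j (ranks x j).
--   (2) Every ranking puts the same number of alternatives into each block.
--       So when one voter swaps two alternatives j and j', the blocks of the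
--       other alternatives stay put, and j and j' either keep their blocks or
--       exchange them: F has the "exchange property".
--   (3) A pivotal-voter argument, which needs a third alternative (m ≥ 3),
--       shows that a rule F with the exchange property either ignores the rank
--       vector or is a function of the rank given by one voter i.
--   (4) In the first case f is constant.  In the second, β x j depends only on
--       the rank of j in x_i, i.e. f(x) = {x_i ∘ y ∘ h : h ∈ H} for y = f(x₀),
--       x₀ the profile in which every voter submits the identity ranking.

open import Defs
open import Data.Nat using (ℕ; suc; _+_; _≤_; s≤s)
open import Data.Nat.Properties using (+-0-commutativeMonoid; +-assoc; +-comm; +-cancelˡ-≡; +-cancelʳ-≡)
open import Data.Fin using (Fin; zero; suc; _≟_)
open import Data.Fin.Properties using (all?; ¬∀⟶∃¬; punchInᵢ≢i)
open import Data.Fin.Permutation using (_⟨$⟩ʳ_; _⟨$⟩ˡ_; inverseˡ; inverseʳ; transpose; flip; _∘ₚ_) renaming (id to idₚ)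
import Data.Fin.Permutation.Components as PC
open import Data.Vec.Functional using (removeAt)
open import Algebra.Properties.CommutativeMonoid.Sum +-0-commutativeMonoid using (sum; sum-remove; sum-permute; sum-cong-≗)
open import Data.List using (List; []; _∷_; allFin)
open import Data.List.Relation.Unary.Any using (here; there)
open import Data.List.Membership.Propositional using (_∈_)
open import Data.List.Membership.Propositional.Properties using (∈-allFin)
open import Data.Product using (Σ; _×_; _,_; proj₁; proj₂)
open import Data.Sum as Sum using (_⊎_; inj₁; inj₂)
open import Data.Empty using (⊥-elim)
open import Function using (_∘_; const)
open import Function.Bundles using (mk⇔; Equivalence)
open import Relation.Binary.PropositionalEquality using (_≡_; _≢_; refl; sym; trans; cong; _≗_; module ≡-Reasoning)
open import Relation.Nullary using (yes; no; ¬_)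

open ≡-Reasoning

_[_≔_] : ∀ {A : Set} {n} → (Fin n → A) → Fin n → A → Fin n → A
(f [ i ≔ a ]) q with q ≟ i
... | yes _ = a
... | no _ = f q

assign-here : ∀ {A : Set} {n} (f : Fin n → A) i a → (f [ i ≔ a ]) i ≡ a
assign-here f i a with i ≟ i
... | yes _ = refl
... | no i≢i = ⊥-elim (i≢i refl)

assign-other : ∀ {A : Set} {n} (f : Fin n → A) {i q} a → q ≢ i → (f [ i ≔ a ]) q ≡ f q
assign-other f {i} {q} a q≢i with q ≟ i
... | yes q≡i = ⊥-elim (q≢i q≡i)
... | no _ = refl

assign-cong : ∀ {A : Set} {n} {f f' : Fin n → A} i {a a'} → f ≗ f' → a ≡ a' → f [ i ≔ a ] ≗ f' [ i ≔ a' ]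
assign-cong i f≗f' a≡a' q with q ≟ i
... | yes _ = a≡a'
... | no _ = f≗f' q

assign-id : ∀ {A : Set} {n} (f : Fin n → A) i {a} → f i ≡ a → f [ i ≔ a ] ≗ f
assign-id f i fi≡a q with q ≟ i
... | yes refl = sym fi≡a
... | no _ = refl

assign-twice : ∀ {A : Set} {n} (f : Fin n → A) i a c → (f [ i ≔ a ]) [ i ≔ c ] ≗ f [ i ≔ c ]
assign-twice f i a c q with q ≟ i
... | yes _ = refl
... | no q≢i = assign-other f a q≢i

hybrid : ∀ {A : Set} {n} → (Fin n → A) → (Fin n → A) → List (Fin n) → Fin n → A
hybrid f f' [] = f
hybrid f f' (i ∷ is) = hybrid f f' is [ i ≔ f' i ]

hybrid-either : ∀ {A : Set} {n} (f f' : Fin n → A) is q → hybrid f f' is q ≡ f q ⊎ hybrid f f' is q ≡ f' q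
hybrid-either f f' [] q = inj₁ refl
hybrid-either f f' (i ∷ is) q with q ≟ i
... | yes refl = inj₂ refl
... | no _ = hybrid-either f f' is q

hybrid-member : ∀ {A : Set} {n} (f f' : Fin n → A) {is q} → q ∈ is → hybrid f f' is q ≡ f' q
hybrid-member f f' {i ∷ is} {q} q∈ with q ≟ i | q∈
... | yes refl | _ = refl
... | no q≢i | here q≡i = ⊥-elim (q≢i q≡i)
... | no _ | there q∈is = hybrid-member f f' q∈is

hybrid-all : ∀ {A : Set} {n} (f f' : Fin n → A) → hybrid f f' (allFin n) ≗ f'
hybrid-all f f' q = hybrid-member f f' (∈-allFin q)

transpose-left : ∀ {m} (i j : Fin m) → PC.transpose i j i ≡ j
transpose-left i j with i ≟ i
... | yes _ = refl
... | no i≢i = ⊥-elim (i≢i refl)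

transpose-right : ∀ {m} (i j : Fin m) → PC.transpose i j j ≡ i
transpose-right i j with j ≟ i
... | yes j≡i = j≡i
... | no _ with j ≟ j
...   | yes _ = refl
...   | no j≢j = ⊥-elim (j≢j refl)

transpose-other : ∀ {m} (i j : Fin m) {a} → a ≢ i → a ≢ j → PC.transpose i j a ≡ a
transpose-other i j {a} a≢i a≢j with a ≟ i
... | yes a≡i = ⊥-elim (a≢i a≡i)
... | no _ with a ≟ j
...   | yes a≡j = ⊥-elim (a≢j a≡j)
...   | no _ = refl

-- Rankings with prescribed ranks for given alternatives; they are used to
-- realise given rank vectors by profiles.  place j a puts j at rank a.
place : ∀ {m} → Fin m → Fin m → Perm m
place j a = transpose a j

place-rank : ∀ {m} (j a : Fin m) → rank (place j a) j ≡ a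
place-rank j a = transpose-left j a

place₂ : ∀ {m} → Fin m → Fin m → Fin m → Fin m → Perm m
place₂ j a j' c = transpose a j ∘ₚ transpose (PC.transpose a j c) j'

place₂-rankʳ : ∀ {m} (j a j' c : Fin m) → rank (place₂ j a j' c) j' ≡ c
place₂-rankʳ j a j' c = begin
  PC.transpose j a (PC.transpose j' (PC.transpose a j c) j') ≡⟨ cong (PC.transpose j a) (transpose-left j' _) ⟩
  PC.transpose j a (PC.transpose a j c)                      ≡⟨ PC.transpose-inverse j a ⟩
  c                                                          ∎

place₂-rankˡ : ∀ {m} {j a j' c : Fin m} → j ≢ j' → a ≢ c → rank (place₂ j a j' c) j ≡ a
place₂-rankˡ {j = j} {a} {j'} {c} j≢j' a≢c = begin
  PC.transpose j a (PC.transpose j' c' j) ≡⟨ cong (PC.transpose j a) (transpose-other j' c' j≢j' j≢c') ⟩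
  PC.transpose j a j                      ≡⟨ transpose-left j a ⟩
  a                                       ∎
  where
  c' : Fin _
  c' = PC.transpose a j c
  -- j = c' would give a = c after undoing the first transposition
  j≢c' : j ≢ c'
  j≢c' j≡c' = a≢c (trans (sym (transpose-left j a)) (trans (cong (PC.transpose j a) j≡c') (PC.transpose-inverse j a)))

module Cosets {m k} (b : Fin m → Fin k) where

  blocks : Perm m → Fin m → Fin k
  blocks y j = b (rank y j)

  coset⇒blocks : ∀ c z → InCoset b c z → blocks z ≗ blocks c
  coset⇒blocks c z (h , (h-fixes , _) , z≡c∘h) j = begin
    b (rank z j)             ≡⟨ sym (h-fixes (rank z j)) ⟩
    b (h ⟨$⟩ʳ rank z j)       ≡⟨ cong b (sym rank-c) ⟩
    b (rank c j)             ∎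
    where
    rank-c : rank c j ≡ h ⟨$⟩ʳ rank z j
    rank-c = begin
      c ⟨$⟩ˡ j                              ≡⟨ cong (c ⟨$⟩ˡ_) (trans (sym (inverseʳ z)) (z≡c∘h (rank z j))) ⟩
      c ⟨$⟩ˡ (c ⟨$⟩ʳ (h ⟨$⟩ʳ rank z j))     ≡⟨ inverseˡ c ⟩
      h ⟨$⟩ʳ rank z j                       ∎

  -- The witness is h = c⁻¹ ∘ z, which preserves the blocks.
  blocks⇒coset : ∀ c z → blocks z ≗ blocks c → InCoset b c z
  blocks⇒coset c z same = z ∘ₚ flip c , (fixes , fixes⁻¹) , λ r → sym (inverseʳ c)
    where
    fixes : ∀ r → b (c ⟨$⟩ˡ (z ⟨$⟩ʳ r)) ≡ b r
    fixes r = trans (sym (same (z ⟨$⟩ʳ r))) (cong b (inverseˡ z))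
    fixes⁻¹ : ∀ s → b (z ⟨$⟩ˡ (c ⟨$⟩ʳ s)) ≡ b s
    fixes⁻¹ s = trans (same (c ⟨$⟩ʳ s)) (cong b (inverseˡ c))

  selfInCoset : ∀ y → InCoset b y y
  selfInCoset y = blocks⇒coset y y (λ _ → refl)

  sameCoset : ∀ c c' → blocks c ≗ blocks c' → SameSet (InCoset b c) (InCoset b c')
  sameCoset c c' c≗c' z =
    mk⇔ (λ z∈Hc → blocks⇒coset c' z (λ j → trans (coset⇒blocks c z z∈Hc j) (c≗c' j)))
        (λ z∈Hc' → blocks⇒coset c z (λ j → trans (coset⇒blocks c' z z∈Hc' j) (sym (c≗c' j))))

KeptOrSwapped : ∀ {k} → Fin k → Fin k → Fin k → Fin k → Set
KeptOrSwapped A B A' B' = A ≡ A' ⊎ (A ≡ B' × B ≡ A')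

keptOrSwapped-transport : ∀ {k} {A B A' B' A₁ B₁ A₁' B₁' : Fin k} →
  A ≡ A₁ → B ≡ B₁ → A' ≡ A₁' → B' ≡ B₁' → KeptOrSwapped A B A' B' → KeptOrSwapped A₁ B₁ A₁' B₁'
keptOrSwapped-transport refl refl refl refl outcome = outcome

indicator : ∀ {k} → Fin k → Fin k → ℕ
indicator l a with a ≟ l
... | yes _ = 1
... | no _ = 0

indicator-self : ∀ {k} (l : Fin k) → indicator l l ≡ 1
indicator-self l with l ≟ l
... | yes _ = refl
... | no l≢l = ⊥-elim (l≢l refl)

indicator-other : ∀ {k} (l : Fin k) {a} → a ≢ l → indicator l a ≡ 0
indicator-other l {a} a≢l with a ≟ l
... | yes a≡l = ⊥-elim (a≢l a≡l)
... | no _ = refl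

indicator-pos : ∀ {k} (l : Fin k) {a c} → indicator l a ≡ suc c → a ≡ l
indicator-pos l {a} one with a ≟ l
... | yes a≡l = a≡l
... | no _ with one
...   | ()

pair-multiset : ∀ {k} (A B A' B' : Fin k) →
  (∀ l → indicator l A + indicator l B ≡ indicator l A' + indicator l B') → KeptOrSwapped A B A' B'
pair-multiset A B A' B' same with A ≟ A'
... | yes A≡A' = inj₁ A≡A'
... | no A≢A' = inj₂ (sym B'≡A , sym A'≡B)
  where
  -- counting colour A: it occurs on the left, not as A', hence as B'
  B'≡A : B' ≡ A
  B'≡A = indicator-pos A (begin
    indicator A B'                     ≡⟨ cong (_+ indicator A B') (sym (indicator-other A (A≢A' ∘ sym))) ⟩
    indicator A A' + indicator A B'    ≡⟨ sym (same A) ⟩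
    indicator A A + indicator A B      ≡⟨ cong (_+ indicator A B) (indicator-self A) ⟩
    suc (indicator A B)                ∎)
  -- counting colour B, now that B' = A
  A'≡B : A' ≡ B
  A'≡B = indicator-pos B (sym (+-cancelˡ-≡ (indicator B A) 1 (indicator B A') (begin
    indicator B A + 1                  ≡⟨ cong (indicator B A +_) (sym (indicator-self B)) ⟩
    indicator B A + indicator B B      ≡⟨ same B ⟩
    indicator B A' + indicator B B'    ≡⟨ cong (λ c → indicator B A' + indicator B c) B'≡A ⟩
    indicator B A' + indicator B A     ≡⟨ +-comm (indicator B A') (indicator B A) ⟩
    indicator B A + indicator B A'     ∎)))

sum-split : ∀ {m} (u : Fin m → ℕ) i → sum u ≡ u i + sum (u [ i ≔ 0 ])
sum-split {suc m} u i = begin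
  sum u                                 ≡⟨ sum-remove {i = i} u ⟩
  u i + sum (removeAt u i)              ≡⟨ cong (u i +_) (sum-cong-≗ λ q → sym (assign-other u 0 (punchInᵢ≢i i q))) ⟩
  u i + sum (removeAt (u [ i ≔ 0 ]) i)  ≡⟨ cong (λ t → u i + (t + sum (removeAt (u [ i ≔ 0 ]) i))) (assign-here u i 0) ⟨
  u i + ((u [ i ≔ 0 ]) i + sum (removeAt (u [ i ≔ 0 ]) i))  ≡⟨ cong (u i +_) (sum-remove {i = i} (u [ i ≔ 0 ])) ⟨
  u i + sum (u [ i ≔ 0 ])               ∎

sum-pair : ∀ {m} {j j' : Fin m} → j ≢ j' → (u u' : Fin m → ℕ) →
  (∀ q → q ≢ j → q ≢ j' → u q ≡ u' q) → sum u ≡ sum u' → u j + u j' ≡ u' j + u' j'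
sum-pair {m} {j} {j'} j≢j' u u' agree sum≡ = +-cancelʳ-≡ (rest u) (u j + u j') (u' j + u' j') (begin
  u j + u j' + rest u       ≡⟨ sym (split u) ⟩
  sum u                     ≡⟨ sum≡ ⟩
  sum u'                    ≡⟨ split u' ⟩
  u' j + u' j' + rest u'    ≡⟨ cong (u' j + u' j' +_) (sum-cong-≗ rest-agree) ⟨
  u' j + u' j' + rest u     ∎)
  where
  rest : (Fin m → ℕ) → ℕ
  rest w = sum ((w [ j ≔ 0 ]) [ j' ≔ 0 ])
  split : ∀ w → sum w ≡ w j + w j' + rest w
  split w = begin
    sum w                                   ≡⟨ sum-split w j ⟩
    w j + sum (w [ j ≔ 0 ])                 ≡⟨ cong (w j +_) (sum-split (w [ j ≔ 0 ]) j') ⟩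
    w j + ((w [ j ≔ 0 ]) j' + rest w)       ≡⟨ cong (λ t → w j + (t + rest w)) (assign-other w 0 (j≢j' ∘ sym)) ⟩
    w j + (w j' + rest w)                   ≡⟨ +-assoc (w j) (w j') (rest w) ⟨
    w j + w j' + rest w                     ∎
  rest-agree : ∀ q → ((u [ j ≔ 0 ]) [ j' ≔ 0 ]) q ≡ ((u' [ j ≔ 0 ]) [ j' ≔ 0 ]) q
  rest-agree q with q ≟ j'
  ... | yes _ = refl
  ... | no q≢j' with q ≟ j
  ...   | yes _ = refl
  ...   | no q≢j = agree q q≢j q≢j'

count : ∀ {m k} → (Fin m → Fin k) → Fin k → ℕ
count c l = sum (λ q → indicator l (c q))

count-permute : ∀ {m k} (c : Fin m → Fin k) (π : Perm m) l → count (λ r → c (π ⟨$⟩ʳ r)) l ≡ count c l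
count-permute c π l = sym (sum-permute (λ q → indicator l (c q)) π)

colourings-exchange : ∀ {m k} (c c' : Fin m → Fin k) {j j'} → j ≢ j' →
  (∀ l → count c l ≡ count c' l) → (∀ q → q ≢ j → q ≢ j' → c q ≡ c' q) →
  KeptOrSwapped (c j) (c j') (c' j) (c' j')
colourings-exchange c c' j≢j' same-counts agree = pair-multiset _ _ _ _ λ l →
  sum-pair j≢j' _ _ (λ q q≢j q≢j' → cong (indicator l) (agree q q≢j q≢j')) (same-counts l)

-- Rank vectors v : Fin n → Fin m record the rank that each voter gives to one
-- alternative.  Two rank vectors are disjoint if no voter uses the same rank.
Disjoint : ∀ {m n} → (Fin n → Fin m) → (Fin n → Fin m) → Set
Disjoint v w = ∀ q → v q ≢ w q

-- A rule F assigning a block to each alternative j and rank vector v has the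
-- exchange property if, when voter i swaps j (at rank v i) with j' (at rank
-- w i), j keeps its block or j and j' exchange their blocks.
Exchange : ∀ {m n k} → (Fin m → (Fin n → Fin m) → Fin k) → Set
Exchange {m} {n} F = ∀ j j' → j ≢ j' → ∀ v w → Disjoint {m} {n} v w → ∀ i →
  KeptOrSwapped (F j v) (F j' w) (F j (v [ i ≔ w i ])) (F j' (w [ i ≔ v i ]))

Dictator : ∀ {m n k} → (Fin m → (Fin n → Fin m) → Fin k) → Set
Dictator {m} {n} {k} F = Σ (Fin n) λ i → Σ (Fin m → Fin k) λ D → ∀ j u → F j u ≡ D (u i)

-- The pivotal-voter argument.  The parameter third provides, for any two
-- alternatives, a third one different from both (this is where m ≥ 3 enters).
module PivotalVoter {m n k} (F : Fin m → (Fin n → Fin m) → Fin k)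
  (F-cong : ∀ j {v v'} → v ≗ v' → F j v ≡ F j v') (exchange : Exchange F)
  (third : Fin m → Fin m → Fin m)
  (third-≢ˡ : ∀ a c → third a c ≢ a) (third-≢ʳ : ∀ a c → third a c ≢ c) where

  Pivot : Fin m → (Fin n → Fin m) → Fin n → Fin m → Set
  Pivot j v i t = F j v ≢ F j (v [ i ≔ t ])

  SomePivot : Set
  SomePivot = Σ (Fin m) λ j → Σ (Fin n → Fin m) λ v → Σ (Fin n) λ i → Σ (Fin m) λ t → Pivot j v i t

  -- A pivot for j transfers to any other alternative j' whose rank vector w is
  -- disjoint from v and puts j' at rank t for voter i: the exchange must swap.
  pivot-transfer : ∀ {j v i t} → Pivot j v i t → ∀ {j' w} → j' ≢ j → Disjoint v w → w i ≡ t →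
    F j' w ≡ F j (v [ i ≔ t ]) × F j' (w [ i ≔ v i ]) ≡ F j v
  pivot-transfer {j} {v} {i} {t} pivot {j'} {w} j'≢j disjoint wi≡t with exchange j j' (j'≢j ∘ sym) v w disjoint i
  ... | inj₁ kept = ⊥-elim (pivot (trans kept (F-cong j (assign-cong i (λ _ → refl) wi≡t))))
  ... | inj₂ (swapped , swapped') = trans swapped' (F-cong j (assign-cong i (λ _ → refl) wi≡t)) , sym swapped

  -- Pass the pivot to a third alternative
  -- j' with a rank vector w disjoint from v and u, and from there to u.
  pivot-origin : ∀ {j v i t} → Pivot j v i t → ∀ j'' u → u i ≡ v i → F j'' u ≡ F j v
  pivot-origin {j} {v} {i} {t} pivot j'' u ui≡vi = trans (proj₁ to-u) (proj₂ to-w)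
    where
    j' : Fin m
    j' = third j j''
    w : Fin n → Fin m
    w = (λ q → third (v q) (u q)) [ i ≔ t ]
    vi≢t : v i ≢ t
    vi≢t vi≡t = pivot (F-cong j (λ q → sym (assign-id v i vi≡t q)))
    v-w-disjoint : Disjoint v w
    v-w-disjoint q with q ≟ i
    ... | yes refl = vi≢t
    ... | no _ = third-≢ˡ (v q) (u q) ∘ sym
    w-u-disjoint : Disjoint w u
    w-u-disjoint q with q ≟ i
    ... | yes refl = λ t≡ui → vi≢t (sym (trans t≡ui ui≡vi))
    ... | no _ = third-≢ʳ (v q) (u q)
    to-w : F j' w ≡ F j (v [ i ≔ t ]) × F j' (w [ i ≔ v i ]) ≡ F j v
    to-w = pivot-transfer pivot (third-≢ˡ j j'') v-w-disjoint (assign-here _ i t)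
    pivot' : Pivot j' w i (v i)
    pivot' e = pivot (trans (sym (proj₂ to-w)) (trans (sym e) (proj₁ to-w)))
    to-u : F j'' u ≡ F j' (w [ i ≔ v i ]) × F j'' (u [ i ≔ w i ]) ≡ F j' w
    to-u = pivot-transfer pivot' (third-≢ʳ j j'' ∘ sym) w-u-disjoint ui≡vi

  pivot-reverse : ∀ {j v i t} → Pivot j v i t → Pivot j (v [ i ≔ t ]) i (v i)
  pivot-reverse {j} {v} {i} {t} pivot e = pivot (begin
    F j v                            ≡⟨ F-cong j (λ q → trans (sym (assign-id v i refl q)) (sym (assign-twice v i t (v i) q))) ⟩
    F j ((v [ i ≔ t ]) [ i ≔ v i ])  ≡⟨ e ⟨
    F j (v [ i ≔ t ])                ∎)

  pivot-target : ∀ {j v i t} → Pivot j v i t → ∀ j'' u → u i ≡ t → F j'' u ≡ F j (v [ i ≔ t ])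
  pivot-target {v = v} {i} {t} pivot j'' u ui≡t =
    pivot-origin (pivot-reverse pivot) j'' u (trans ui≡t (sym (assign-here v i t)))

  -- A pivotal voter is a dictator: F j'' u = F j (v [ i ≔ u i ]).  Either
  -- (j, v, i, u i) or (j, v [ i ≔ t ], i, u i) is itself a pivot.
  pivot-dictator : ∀ {j v i t} → Pivot j v i t → ∀ j'' u → F j'' u ≡ F j (v [ i ≔ u i ])
  pivot-dictator {j} {v} {i} {t} pivot j'' u with F j v ≟ F j (v [ i ≔ u i ])
  ... | no pivot-at-ui = pivot-target pivot-at-ui j'' u refl
  ... | yes unmoved = trans (pivot-target pivot-from-t j'' u refl) (F-cong j (assign-twice v i t (u i)))
    where
    pivot-from-t : Pivot j (v [ i ≔ t ]) i (u i)
    pivot-from-t e = pivot (begin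
      F j v                            ≡⟨ unmoved ⟩
      F j (v [ i ≔ u i ])              ≡⟨ F-cong j (assign-twice v i t (u i)) ⟨
      F j ((v [ i ≔ t ]) [ i ≔ u i ])  ≡⟨ e ⟨
      F j (v [ i ≔ t ])                ∎)

  pivot⇒unanimous-varies : SomePivot → ∀ j₀ r₀ → ¬ (∀ r → F j₀ (const r) ≡ F j₀ (const r₀))
  pivot⇒unanimous-varies (j , v , i , t , pivot) j₀ r₀ flat = pivot (begin
    F j v                 ≡⟨ F-cong j (λ q → sym (assign-id v i refl q)) ⟩
    F j (v [ i ≔ v i ])   ≡⟨ pivot-dictator pivot j₀ (const (v i)) ⟨
    F j₀ (const (v i))    ≡⟨ flat (v i) ⟩
    F j₀ (const r₀)       ≡⟨ flat t ⟨
    F j₀ (const t)        ≡⟨ pivot-dictator pivot j₀ (const t) ⟩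
    F j (v [ i ≔ t ])     ∎)

  equal-or-pivot : ∀ j v u → F j v ≡ F j u ⊎ SomePivot
  equal-or-pivot j v u = Sum.map₁ (λ e → trans e (F-cong j (hybrid-all v u))) (along (allFin n))
    where
    along : ∀ is → F j v ≡ F j (hybrid v u is) ⊎ SomePivot
    along [] = inj₁ refl
    along (i ∷ is) with along is
    ... | inj₂ pivot = inj₂ pivot
    ... | inj₁ e with F j (hybrid v u is) ≟ F j (hybrid v u (i ∷ is))
    ...   | yes e' = inj₁ (trans e e')
    ...   | no pivot = inj₂ (j , hybrid v u is , i , u i , pivot)

  -- Decide whether unanimous rank vectors all give j₀ the same block: if so
  -- no pivot exists and F j is constant; otherwise equal-or-pivot finds one.
  constant-or-dictator : Fin m → (∀ j v u → F j v ≡ F j u) ⊎ Dictator F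
  constant-or-dictator j₀ with all? (λ r → F j₀ (const r) ≟ F j₀ (const j₀))
  ... | yes flat = inj₁ λ j v u →
        Sum.[ (λ e → e) , (λ pivot → ⊥-elim (pivot⇒unanimous-varies pivot j₀ j₀ flat)) ] (equal-or-pivot j v u)
  ... | no ¬flat with ¬∀⟶∃¬ m _ (λ r → F j₀ (const r) ≟ F j₀ (const j₀)) ¬flat
  ...   | r , varies with equal-or-pivot j₀ (const r) (const j₀)
  ...     | inj₁ same = ⊥-elim (varies same)
  ...     | inj₂ (j , v , i , t , pivot) = inj₂ (i , (λ s → F j (v [ i ≔ s ])) , pivot-dictator pivot)

ranks : ∀ {m n} → Profile m n → Fin m → Fin n → Fin m
ranks x j q = rank (x q) j

ranks-assign : ∀ {m n} (x : Profile m n) i y j → ranks (x [ i ≔ y ]) j ≗ ranks x j [ i ≔ rank y j ]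
ranks-assign x i y j q with q ≟ i
... | yes _ = refl
... | no _ = refl

update≗assign : ∀ {m n} (x : Profile m n) i y → update x i y ≗ x [ i ≔ y ]
update≗assign x i y q with q ≟ i
... | yes _ = refl
... | no _ = refl

swapIn : ∀ {m n} → Profile m n → Fin n → Fin m → Fin m → Profile m n
swapIn x i j j' = x [ i ≔ x i ∘ₚ transpose j j' ]

placing : ∀ {m n} → Fin m → (Fin n → Fin m) → Profile m n
placing j v q = place j (v q)

placing₂ : ∀ {m n} → Fin m → (Fin n → Fin m) → Fin m → (Fin n → Fin m) → Profile m n
placing₂ j v j' w q = place₂ j (v q) j' (w q)

module Aggregator {m n k} (b : Fin m → Fin k) (g : Profile m n → Perm m)
  (well-defined : WellDefined b g) (ir : IR b g) where

  open Cosets b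

  β : Profile m n → Fin m → Fin k
  β x = blocks (g x)

  β-cong : ∀ {x x'} → (∀ i → x i ≈ₚ x' i) → β x ≗ β x'
  β-cong {x} {x'} x≈x' = λ j → sym (coset⇒blocks (g x) (g x') g-x'∈Hgx j)
    where
    g-x'∈Hgx : InCoset b (g x) (g x')
    g-x'∈Hgx = Equivalence.from (well-defined x x' x≈x' (g x')) (selfInCoset (g x'))

  β-assign : ∀ i j x y → rank (x i) j ≡ rank y j → β x j ≡ β (x [ i ≔ y ]) j
  β-assign i j x y same with ir i j x y same
  ... | φ , _ , _ , _ , _ , _ , keeps-rank = begin
    b (rank (g x) j)           ≡⟨ cong b (keeps-rank self) ⟨
    b (rank (proj₁ (φ self)) j) ≡⟨ coset⇒blocks (g (update x i y)) (proj₁ (φ self)) (proj₂ (φ self)) j ⟩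
    β (update x i y) j         ≡⟨ β-cong (λ q r → cong (_⟨$⟩ʳ r) (update≗assign x i y q)) j ⟩
    β (x [ i ≔ y ]) j          ∎
    where
    self : Elt b (g x)
    self = g x , selfInCoset (g x)

  β-ranks : ∀ j x x' → ranks x j ≗ ranks x' j → β x j ≡ β x' j
  β-ranks j x x' same = trans (along (allFin n)) (β-cong (λ q r → cong (_⟨$⟩ʳ r) (hybrid-all x x' q)) j)
    where
    rank-agrees : ∀ {i z} → z ≡ x i ⊎ z ≡ x' i → rank z j ≡ rank (x' i) j
    rank-agrees {i} (inj₁ refl) = same i
    rank-agrees (inj₂ refl) = refl
    along : ∀ is → β x j ≡ β (hybrid x x' is) j
    along [] = refl
    along (i ∷ is) = trans (along is) (β-assign i j _ (x' i) (rank-agrees (hybrid-either x x' is i)))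

  F : Fin m → (Fin n → Fin m) → Fin k
  F j v = β (placing j v) j

  β≡F : ∀ x j {v} → ranks x j ≗ v → β x j ≡ F j v
  β≡F x j x≗v = β-ranks j x (placing j _) (λ q → trans (x≗v q) (sym (place-rank j _)))

  F-cong : ∀ j {v v'} → v ≗ v' → F j v ≡ F j v'
  F-cong j {v} v≗v' = β≡F (placing j v) j (λ q → trans (place-rank j (v q)) (v≗v' q))

  -- Swapping two alternatives moves no other alternative, and every ranking
  -- has the same number of alternatives in each block; so j and j' keep or
  -- exchange their blocks.
  swap-exchange : ∀ x i {j j'} → j ≢ j' → KeptOrSwapped (β x j) (β x j') (β (swapIn x i j j') j) (β (swapIn x i j j') j')
  swap-exchange x i {j} {j'} j≢j' = colourings-exchange (β x) (β x') j≢j' same-counts others-fixed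
    where
    x' : Profile m n
    x' = swapIn x i j j'
    same-counts : ∀ l → count (β x) l ≡ count (β x') l
    same-counts l = trans (count-permute b (flip (g x)) l) (sym (count-permute b (flip (g x')) l))
    others-fixed : ∀ a → a ≢ j → a ≢ j' → β x a ≡ β x' a
    others-fixed a a≢j a≢j' = β-ranks a x x' λ q → sym (begin
      ranks x' a q                                  ≡⟨ ranks-assign x i _ a q ⟩
      (ranks x a [ i ≔ rank (x i) (PC.transpose j' j a) ]) q
                                                    ≡⟨ assign-id (ranks x a) i (cong (rank (x i)) (sym (transpose-other j' j a≢j' a≢j))) q ⟩
      ranks x a q                                   ∎)

  -- F has the exchange property: realise the rank vectors v and w of j and j'
  -- by one profile and apply swap-exchange.
  exchange : Exchange F
  exchange j j' j≢j' v w disjoint i =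
    keptOrSwapped-transport (β≡F x j x-j) (β≡F x j' x-j') (β≡F x' j x'-j) (β≡F x' j' x'-j') (swap-exchange x i j≢j')
    where
    x x' : Profile m n
    x = placing₂ j v j' w
    x' = swapIn x i j j'
    x-j : ranks x j ≗ v
    x-j q = place₂-rankˡ j≢j' (disjoint q)
    x-j' : ranks x j' ≗ w
    x-j' q = place₂-rankʳ j (v q) j' (w q)
    x'-j : ranks x' j ≗ v [ i ≔ w i ]
    x'-j q = trans (ranks-assign x i _ j q) (assign-cong i x-j (trans (cong (rank (x i)) (transpose-right j' j)) (x-j' i)) q)
    x'-j' : ranks x' j' ≗ w [ i ≔ v i ]
    x'-j' q = trans (ranks-assign x i _ j' q) (assign-cong i x-j' (trans (cong (rank (x i)) (transpose-left j' j)) (x-j i)) q)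

  constant : (∀ j v u → F j v ≡ F j u) → Constant b g
  constant F-flat x x' = sameCoset (g x) (g x') λ j →
    trans (β≡F x j (λ _ → refl)) (trans (F-flat j _ _) (sym (β≡F x' j (λ _ → refl))))

  dictatorial : Dictator F → Dictatorial b g
  dictatorial (i , D , F≡D) = i , g x₀ , λ x → sameCoset (g x) (g x₀ ∘ₚ x i) λ j →
    trans (β-via-D x j) (sym (β-via-D x₀ (rank (x i) j)))
    where
    x₀ : Profile m n
    x₀ _ = idₚ
    β-via-D : ∀ x j → β x j ≡ D (rank (x i) j)
    β-via-D x j = trans (β≡F x j (λ _ → refl)) (F≡D j (ranks x j))

third : ∀ {m} → Fin (3 + m) → Fin (3 + m) → Fin (3 + m)
third zero zero = suc zero
third zero (suc zero) = suc (suc zero)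
third zero (suc (suc _)) = suc zero
third (suc zero) zero = suc (suc zero)
third (suc zero) (suc _) = zero
third (suc (suc _)) zero = suc zero
third (suc (suc _)) (suc _) = zero

third-≢ˡ : ∀ {m} (a c : Fin (3 + m)) → third a c ≢ a
third-≢ˡ zero zero ()
third-≢ˡ zero (suc zero) ()
third-≢ˡ zero (suc (suc _)) ()
third-≢ˡ (suc zero) zero ()
third-≢ˡ (suc zero) (suc _) ()
third-≢ˡ (suc (suc _)) zero ()
third-≢ˡ (suc (suc _)) (suc _) ()

third-≢ʳ : ∀ {m} (a c : Fin (3 + m)) → third a c ≢ c
third-≢ʳ zero zero ()
third-≢ʳ zero (suc zero) ()
third-≢ʳ zero (suc (suc _)) ()
third-≢ʳ (suc zero) zero ()
third-≢ʳ (suc zero) (suc _) ()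
third-≢ʳ (suc (suc _)) zero ()
third-≢ʳ (suc (suc _)) (suc _) ()

theorem3p9 : (m n k : ℕ) → 3 ≤ m → 1 ≤ n → 2 ≤ k →
    (b : Fin m → Fin k) → Surjective b →
    (g : Profile m n → Perm m) → WellDefined b g → IR b g →
    Constant b g ⊎ Dictatorial b g
theorem3p9 (suc (suc (suc m))) n k (s≤s (s≤s (s≤s _))) _ _ b _ g well-defined ir =
  Sum.map constant dictatorial (constant-or-dictator zero)
  where
  open Aggregator b g well-defined ir
  open PivotalVoter F F-cong exchange third third-≢ˡ third-≢ʳ
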